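{- Let $L_a$ be the alternating path: the directed graph with vertex set $\mathbb{N}$ whose edges are, for each $i\in\mathbb{N}$, the single ordered pair from $\{(i,i+1),(i+1,i)\}$ that goes from the odd element of $\{i,i+1\}$ to the even one. Let $f$ be the Fibonacci sequence with $f(1)=1$, $f(2)=2$, $f(n)=f(n-1)+f(n-2)$ for $n\ge3$. Then for every $n\in\mathbb{N}$, $$N(L_a,n)\geq f(n).$$
   Context: For a directed graph $G$ with vertex set $\mathbb{N}$ and $n\in\mathbb{N}$, two permutations $\pi,\rho$ of $[n]=\{1,\dots,n\}$ are called $G$-different if there is $i\in[n]$ with $(\pi(i),\rho(i))\in E(G)$. A set of permutations is pairwise $G$-different if every ordered pair of distinct members $(\pi,\rho)$ of it is $G$-different. $N(G,n)$ denotes the largest cardinality of a set of pairwise $G$-different permutations of $[n]$. -}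

module Defs where

open import Data.Nat using (ℕ; zero; suc; _+_)
open import Data.Nat.Properties using ()
open import Data.Fin using (Fin; toℕ)
open import Data.Product using (Σ; ∃; _×_; _,_)
open import Data.Sum using (_⊎_)
open import Relation.Nullary using (¬_)
open import Relation.Binary.PropositionalEquality using (_≡_; _≢_)
open import Data.Nat using (_%_)
open import Function.Bundles using (Bijection; _⤖_)
open Bijection using (to)

Digraph : Set₁
Digraph = ℕ → ℕ → Set

-- Permutations of [n] = {1,…,n}, represented as bijections of Fin n;
-- element k : Fin n stands for the number toℕ k + 1 ∈ [n].
Perm : ℕ → Set
Perm n = Fin n ⤖ Fin n

val : ∀ {n} → Perm n → Fin n → ℕ
val π i = suc (toℕ (to π i))

GDifferent : (G : Digraph) {n : ℕ} → Perm n → Perm n → Set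
GDifferent G {n} π ρ = Σ (Fin n) λ i → G (val π i) (val ρ i)

PermDistinct : ∀ {n} → Perm n → Perm n → Set
PermDistinct {n} π ρ = Σ (Fin n) λ i → to π i ≢ to ρ i

-- N(G,n) ≥ k : there is a set of k permutations of [n] (a family indexed by
-- Fin k with pairwise distinct members) that is pairwise G-different.
N≥ : Digraph → ℕ → ℕ → Set
N≥ G n k = Σ (Fin k → Perm n) λ P →
  ∀ (a b : Fin k) → a ≢ b → PermDistinct (P a) (P b) × GDifferent G (P a) (P b)

data La : ℕ → ℕ → Set where
  odd-up   : ∀ {i} → i % 2 ≡ 1 → La i (suc i)
  odd-down : ∀ {i} → i % 2 ≡ 0 → La (suc i) i

-- Fibonacci with f(1)=1, f(2)=2, f(n)=f(n-1)+f(n-2); f(0) is an unused filler.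
fib : ℕ → ℕ
fib zero = 1
fib (suc zero) = 1
fib (suc (suc zero)) = 2
fib (suc (suc (suc n))) = fib (suc (suc n)) + fib (suc n)

module Submission where

-- Tile the row 1,…,n by monomers (one cell) and dimers (two
-- adjacent cells); there are fib n such tilings.  A tiling determines the
-- involution of [n] that swaps the two cells of every dimer and fixes every
-- monomer.  We show that the involutions of two distinct tilings c, d are
-- La-different, i.e. some position i has π(i) odd and ρ(i) = π(i) ± 1.
-- Past the common prefix, one tiling has a dimer where the other has a
-- monomer; either the first position already carries an La-edge, or (for the
-- wrong parity) the two tilings continue in a "staggered" pattern of dimers
-- shifted by one cell, and the edge is found where the staggering ends
-- ('staggered-even' / 'staggered-odd', a mutual induction that alternates
-- the parity).  Finally the tilings of [n] are enumerated injectively by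
-- Fin (fib n), which yields fib n pairwise La-different permutations.

open import Defs
open import Data.Nat using (ℕ; _≥_; zero; suc; _+_; _%_)
open import Data.Nat.Properties using (+-suc; +-comm)
open import Data.Fin using (Fin; toℕ; join; splitAt)
import Data.Fin as F
open import Data.Fin.Properties using (join-splitAt)
open import Data.Product using (Σ; ∃; _,_)
open import Data.Sum using (_⊎_; inj₁; inj₂)
open import Data.Empty using (⊥-elim)
open import Relation.Nullary using (¬_)
open import Relation.Binary.PropositionalEquality
  using (_≡_; _≢_; refl; sym; trans; cong; cong₂; subst; subst₂; module ≡-Reasoning)
open import Function.Bundles using (mk⤖)
open import Function.Definitions using (Injective)

GDifferent⇒PermDistinct : ∀ (G : Digraph) {n} {π ρ : Perm n} →
  (∀ {x} → ¬ G x x) → GDifferent G π ρ → PermDistinct π ρ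
GDifferent⇒PermDistinct G loopFree (i , e) =
  i , λ πi≡ρi → loopFree (subst (λ y → G (suc (toℕ y)) _) πi≡ρi e)

N≥-from-GDifferent : ∀ (G : Digraph) {n k} → (∀ {x} → ¬ G x x) →
  (P : Fin k → Perm n) → (∀ a b → a ≢ b → GDifferent G (P a) (P b)) → N≥ G n k
N≥-from-GDifferent G loopFree P sep =
  P , λ a b a≢b → GDifferent⇒PermDistinct G {π = P a} {ρ = P b} loopFree (sep a b a≢b) , sep a b a≢b

parity : ∀ k → k % 2 ≡ 0 ⊎ k % 2 ≡ 1
parity zero = inj₁ refl
parity (suc zero) = inj₂ refl
parity (suc (suc k)) = parity k

even⇒suc-odd : ∀ k → k % 2 ≡ 0 → suc k % 2 ≡ 1
even⇒suc-odd zero _ = refl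
even⇒suc-odd (suc (suc k)) = even⇒suc-odd k

odd⇒suc-even : ∀ k → k % 2 ≡ 1 → suc k % 2 ≡ 0
odd⇒suc-even (suc zero) _ = refl
odd⇒suc-even (suc (suc k)) = odd⇒suc-even k

-- The alternating path has no loops: every edge joins i and i + 1.
La-loopFree : ∀ {x} → ¬ La x x
La-loopFree ()

data Tiling : ℕ → Set where
  empty : Tiling zero
  mono  : ∀ {n} → Tiling n → Tiling (suc n)
  dimer : ∀ {n} → Tiling n → Tiling (suc (suc n))

swap : ∀ {n} → Tiling n → Fin n → Fin n
swap (mono t) F.zero = F.zero
swap (mono t) (F.suc i) = F.suc (swap t i)
swap (dimer t) F.zero = F.suc F.zero
swap (dimer t) (F.suc F.zero) = F.zero
swap (dimer t) (F.suc (F.suc i)) = F.suc (F.suc (swap t i))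

swap-involutive : ∀ {n} (t : Tiling n) i → swap t (swap t i) ≡ i
swap-involutive (mono t) F.zero = refl
swap-involutive (mono t) (F.suc i) = cong F.suc (swap-involutive t i)
swap-involutive (dimer t) F.zero = refl
swap-involutive (dimer t) (F.suc F.zero) = refl
swap-involutive (dimer t) (F.suc (F.suc i)) = cong (λ j → F.suc (F.suc j)) (swap-involutive t i)

-- An involution is a bijection.
toPerm : ∀ {n} → Tiling n → Perm n
toPerm t = mk⤖ {to = swap t} (injective , surjective)
  where
  injective : ∀ {x y} → swap t x ≡ swap t y → x ≡ y
  injective {x} {y} e =
    trans (sym (swap-involutive t x)) (trans (cong (swap t) e) (swap-involutive t y))
  surjective : ∀ y → ∃ λ x → ∀ {z} → z ≡ x → swap t z ≡ y
  surjective y = swap t y , λ { refl → swap-involutive t y }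

-- 'value t k i': the image of position i when the tiling t is laid on the
-- cells k, k+1, …; recursion on the tiling moves the offset k along.
value : ∀ {n} → Tiling n → ℕ → Fin n → ℕ
value (mono t) k F.zero = k
value (mono t) k (F.suc i) = value t (suc k) i
value (dimer t) k F.zero = suc k
value (dimer t) k (F.suc F.zero) = k
value (dimer t) k (F.suc (F.suc i)) = value t (suc (suc k)) i

value-offset : ∀ {n} (t : Tiling n) k i → value t k i ≡ toℕ (swap t i) + k
value-offset (mono t) k F.zero = refl
value-offset (mono t) k (F.suc i) = trans (value-offset t (suc k) i) (+-suc _ k)
value-offset (dimer t) k F.zero = refl
value-offset (dimer t) k (F.suc F.zero) = refl
value-offset (dimer t) k (F.suc (F.suc i)) = begin
  value t (suc (suc k)) i             ≡⟨ value-offset t (suc (suc k)) i ⟩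
  toℕ (swap t i) + suc (suc k)        ≡⟨ +-suc _ (suc k) ⟩
  suc (toℕ (swap t i) + suc k)        ≡⟨ cong suc (+-suc _ k) ⟩
  suc (suc (toℕ (swap t i) + k))      ∎
  where open ≡-Reasoning

value-from-1 : ∀ {n} (t : Tiling n) i → value t 1 i ≡ val (toPerm t) i
value-from-1 t i = trans (value-offset t 1 i) (+-comm _ 1)

Separated : ∀ {n} → ℕ → Tiling n → Tiling n → Set
Separated {n} k c d = Σ (Fin n) λ i → La (value c k i) (value d k i)

-- Staggered tilings: one starts with a dimer on {k, k+1}, the other with a
-- monomer on k.  The first cell carries the edge between k and k+1 in one
-- direction only; the other direction is found strictly later, at the end of
-- the run of dimers shifted by one cell against each other.  Each of the two
-- lemmas handles the direction that fails at the first cell for its parity.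
staggered-even : ∀ {n} k → k % 2 ≡ 0 → (c : Tiling n) (d : Tiling (suc n)) →
  Σ (Fin (suc n)) λ i → La (value (mono d) k (F.suc i)) (value (dimer c) k (F.suc i))
staggered-odd : ∀ {n} k → k % 2 ≡ 1 → (c : Tiling n) (d : Tiling (suc n)) →
  Σ (Fin (suc n)) λ i → La (value (dimer c) k (F.suc i)) (value (mono d) k (F.suc i))

staggered-even k even c (mono d) = F.zero , odd-down even
staggered-even k even (mono c) (dimer d) = F.suc F.zero , odd-up (even⇒suc-odd k even)
staggered-even k even (dimer c) (dimer d)
  with i , edge ← staggered-odd (suc k) (even⇒suc-odd k even) d (dimer c) = F.suc i , edge

staggered-odd k odd c (mono d) = F.zero , odd-up odd
staggered-odd k odd (mono c) (dimer d) = F.suc F.zero , odd-down (odd⇒suc-even k odd)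
staggered-odd k odd (dimer c) (dimer d)
  with i , edge ← staggered-even (suc k) (odd⇒suc-even k odd) d (dimer c) = F.suc i , edge

-- Distinct tilings are separated: skip the common prefix, then the first
-- tile that differs is a dimer in one tiling and a monomer in the other.
separated : ∀ {n} k (c d : Tiling n) → c ≢ d → Separated k c d
separated k empty empty c≢d = ⊥-elim (c≢d refl)
separated k (mono c) (mono d) c≢d
  with i , edge ← separated (suc k) c d (λ c≡d → c≢d (cong mono c≡d)) = F.suc i , edge
separated k (dimer c) (dimer d) c≢d
  with i , edge ← separated (suc (suc k)) c d (λ c≡d → c≢d (cong dimer c≡d)) = F.suc (F.suc i) , edge
separated k (dimer c) (mono d) _ with parity k
... | inj₁ even = F.zero , odd-down even
... | inj₂ odd with i , edge ← staggered-odd k odd c d = F.suc i , edge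
separated k (mono d) (dimer c) _ with parity k
... | inj₁ even with i , edge ← staggered-even k even c d = F.suc i , edge
... | inj₂ odd = F.zero , odd-up odd

tilings-LaDifferent : ∀ {n} (c d : Tiling n) → c ≢ d → GDifferent La (toPerm c) (toPerm d)
tilings-LaDifferent c d c≢d with i , edge ← separated 1 c d c≢d =
  i , subst₂ La (value-from-1 c i) (value-from-1 d i) edge

tilingCount : ℕ → ℕ
tilingCount zero = 1
tilingCount (suc zero) = 1
tilingCount (suc (suc n)) = tilingCount (suc n) + tilingCount n

tilingCount≡fib : ∀ n → tilingCount n ≡ fib n
tilingCount≡fib zero = refl
tilingCount≡fib (suc zero) = refl
tilingCount≡fib (suc (suc zero)) = refl
tilingCount≡fib (suc (suc (suc n))) =
  cong₂ _+_ (tilingCount≡fib (suc (suc n))) (tilingCount≡fib (suc n))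

mono-injective : ∀ {n} {c d : Tiling n} → mono c ≡ mono d → c ≡ d
mono-injective refl = refl

dimer-injective : ∀ {n} {c d : Tiling n} → dimer c ≡ dimer d → c ≡ d
dimer-injective refl = refl

prependTile : ∀ {n p q} → (Fin p → Tiling (suc n)) → (Fin q → Tiling n) →
  Fin p ⊎ Fin q → Tiling (suc (suc n))
prependTile f g (inj₁ a) = mono (f a)
prependTile f g (inj₂ b) = dimer (g b)

prependTile-injective : ∀ {n p q} {f : Fin p → Tiling (suc n)} {g : Fin q → Tiling n} →
  Injective _≡_ _≡_ f → Injective _≡_ _≡_ g → Injective _≡_ _≡_ (prependTile f g)
prependTile-injective f-inj g-inj {inj₁ a} {inj₁ b} e = cong inj₁ (f-inj (mono-injective e))
prependTile-injective f-inj g-inj {inj₂ a} {inj₂ b} e = cong inj₂ (g-inj (dimer-injective e))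
prependTile-injective f-inj g-inj {inj₁ a} {inj₂ b} ()
prependTile-injective f-inj g-inj {inj₂ a} {inj₁ b} ()

tiling : ∀ n → Fin (tilingCount n) → Tiling n
tiling zero _ = empty
tiling (suc zero) _ = mono empty
tiling (suc (suc n)) i = prependTile (tiling (suc n)) (tiling n) (splitAt (tilingCount (suc n)) i)

splitAt-injective : ∀ m {n} → Injective _≡_ _≡_ (splitAt m {n})
splitAt-injective m {n} {i} {j} e =
  trans (sym (join-splitAt m n i)) (trans (cong (join m n) e) (join-splitAt m n j))

tiling-injective : ∀ n → Injective _≡_ _≡_ (tiling n)
tiling-injective zero {F.zero} {F.zero} _ = refl
tiling-injective (suc zero) {F.zero} {F.zero} _ = refl
tiling-injective (suc (suc n)) e =
  splitAt-injective (tilingCount (suc n))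
    (prependTile-injective (tiling-injective (suc n)) (tiling-injective n) e)

-- The involutions of the fib n tilings of [n] are pairwise La-different.
proposition1 : (n : ℕ) → n ≥ 1 → N≥ La n (fib n)
proposition1 n _ = subst (N≥ La n) (tilingCount≡fib n)
  (N≥-from-GDifferent La La-loopFree (λ a → toPerm (tiling n a))
    (λ a b a≢b → tilings-LaDifferent (tiling n a) (tiling n b)
                   (λ same → a≢b (tiling-injective n same))))
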